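{- Let $p$ be an odd prime. Then $$\sum_{k=0}^{\frac{p-1}{2}}(6k+1)\frac{(\frac12)_k(\frac12-\frac{p}{2})_k(\frac12+\frac{p}{2})_k}{(1)_k(1+\frac{p}{4})_k(1-\frac{p}{4})_k}\cdot\frac{(-1)^k}{8^k}=(-1)^{\frac{p^2-1}{8}+\frac{p-1}{2}}p.$$
   Context: For $a\in\mathbb{C}$ and $k\in\mathbb{N}$, $(a)_k=a(a+1)\cdots(a+k-1)$ denotes the rising factorial, with $(a)_0=1$. -}

module Defs where

open import Data.Nat as ℕ using (ℕ; zero; suc)
open import Data.Integer using (+_)
open import Data.Rational
open import Data.Rational.Properties using (_≟_)
open import Relation.Nullary using (yes; no)

ℕ→ℚ : ℕ → ℚ
ℕ→ℚ n = (+ n) / 1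

-- total division on ℚ (x / 0 = 0); only used with nonzero denominators
_÷'_ : ℚ → ℚ → ℚ
x ÷' y with y ≟ 0ℚ
... | yes _ = 0ℚ
... | no y≢0 = x * (1/_ y {{≢-nonZero y≢0}})

poch : ℚ → ℕ → ℚ
poch a zero = 1ℚ
poch a (suc k) = poch a k * (a + ℕ→ℚ k)

pow : ℚ → ℕ → ℚ
pow x zero = 1ℚ
pow x (suc k) = pow x k * x

sumTo : ℕ → (ℕ → ℚ) → ℚ
sumTo zero f = f 0
sumTo (suc n) f = sumTo n f + f (suc n)

summand : ℕ → ℕ → ℚ
summand p k =
  ((ℕ→ℚ (6 ℕ.* k) + 1ℚ)
    * ((poch ½ k * poch (½ - ℕ→ℚ p * ½) k * poch (½ + ℕ→ℚ p * ½) k)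
       ÷' (poch 1ℚ k * poch (1ℚ + ℕ→ℚ p * (+ 1 / 4)) k
                     * poch (1ℚ - ℕ→ℚ p * (+ 1 / 4)) k)))
    * (pow (- 1ℚ) k ÷' pow (ℕ→ℚ 8) k)

{-# OPTIONS --safe #-}

-- Wilf–Zeilberger induction from p to p + 4, valid for every odd p (p = 1 and p = 3 are checked by
-- computation). Write F(p,k) for the summand and q for p. F(p,k) vanishes for k > (p-1)/2 through
-- the factor (1/2 - p/2)_k. Let B(k) be the hypergeometric term of F(p,k) with 1/2 - p/2 lowered to
-- -3/2 - p/2, so that B(k) vanishes for k > (p+3)/2, and G(k) = -8 (q+2) (q+4) k (q - 4k) B(k). Then
--
--   (q+1) (q+3) (q F(p+4,k) + (q+4) F(p,k)) = G(k+1) - G(k),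
--
-- a polynomial identity once the contiguous relations of the rising factorials express F(p,k),
-- F(p+4,k) and B(k+1) as rational multiples of B(k). Summed over k ≤ (p+3)/2 the right-hand side
-- telescopes to 0, so the sum for p + 4 is -(p+4)/p times the sum for p; the sign exponent grows by
-- p + 4, which is odd.

module Submission where

open import Defs
open import Data.Nat as ℕ using (ℕ; zero; suc; _∸_)
import Data.Nat.Properties as ℕ
open import Data.Nat.DivMod using (m*n/n≡m; +-distrib-/-∣ʳ)
open import Data.Nat.Divisibility using (divides-refl; m∣m*n)
open import Data.Nat.Primality using (Prime; prime⇒irreducible)
open import Data.Nat.Tactic.RingSolver using (solve-∀)
import Data.Integer as ℤ
import Data.Integer.Properties as ℤ
open import Data.Rational
  using (ℚ; 0ℚ; 1ℚ; ½; _+_; _*_; -_; _-_; _/_; 1/_; ≢-nonZero; fromℚᵘ; toℚᵘ)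
import Data.Rational.Properties as ℚ
open import Data.Rational.Unnormalised as ℚᵘ using (ℚᵘ; mkℚᵘ; *≡*)
import Data.Rational.Unnormalised.Properties as ℚᵘ
open import Data.Rational.Solver using (module +-*-Solver)
open import Algebra.Bundles using (CommutativeMonoid)
open import Algebra.Properties.Group ℚ.+-0-group using (x∙y⁻¹≈ε⇒x≈y)
open import Algebra.Properties.CommutativeSemigroup
  (CommutativeMonoid.commutativeSemigroup ℚ.*-1-commutativeMonoid)
  using (xy∙z≈xz∙y; x∙yz≈xz∙y; x∙yz≈y∙xz)
open import Data.Product using (∃; _,_)
open import Data.Sum using (_⊎_; inj₁; inj₂)
open import Relation.Nullary using (yes; no; contradiction)
open import Relation.Binary.PropositionalEquality

open +-*-Solver

fromℚᵘ-homo-+ : ∀ x y → fromℚᵘ (x ℚᵘ.+ y) ≡ fromℚᵘ x + fromℚᵘ y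
fromℚᵘ-homo-+ x y = ℚ.toℚᵘ-injective (begin
  toℚᵘ (fromℚᵘ (x ℚᵘ.+ y))              ≈⟨ ℚ.toℚᵘ-fromℚᵘ (x ℚᵘ.+ y) ⟩
  x ℚᵘ.+ y                              ≈⟨ ℚᵘ.+-cong (ℚ.toℚᵘ-fromℚᵘ x) (ℚ.toℚᵘ-fromℚᵘ y) ⟨
  toℚᵘ (fromℚᵘ x) ℚᵘ.+ toℚᵘ (fromℚᵘ y)  ≈⟨ ℚ.toℚᵘ-homo-+ (fromℚᵘ x) (fromℚᵘ y) ⟨
  toℚᵘ (fromℚᵘ x + fromℚᵘ y)            ∎)
  where open ℚᵘ.≃-Reasoning

fromℚᵘ-homo-* : ∀ x y → fromℚᵘ (x ℚᵘ.* y) ≡ fromℚᵘ x * fromℚᵘ y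
fromℚᵘ-homo-* x y = ℚ.toℚᵘ-injective (begin
  toℚᵘ (fromℚᵘ (x ℚᵘ.* y))              ≈⟨ ℚ.toℚᵘ-fromℚᵘ (x ℚᵘ.* y) ⟩
  x ℚᵘ.* y                              ≈⟨ ℚᵘ.*-cong (ℚ.toℚᵘ-fromℚᵘ x) (ℚ.toℚᵘ-fromℚᵘ y) ⟨
  toℚᵘ (fromℚᵘ x) ℚᵘ.* toℚᵘ (fromℚᵘ y)  ≈⟨ ℚ.toℚᵘ-homo-* (fromℚᵘ x) (fromℚᵘ y) ⟨
  toℚᵘ (fromℚᵘ x * fromℚᵘ y)            ∎)
  where open ℚᵘ.≃-Reasoning

-- ℕ→ℚ n is by definition fromℚᵘ (ℕ→ℚᵘ n).
ℕ→ℚᵘ : ℕ → ℚᵘ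
ℕ→ℚᵘ n = mkℚᵘ (ℤ.+ n) 0

ℕ→ℚ-+ : ∀ m n → ℕ→ℚ (m ℕ.+ n) ≡ ℕ→ℚ m + ℕ→ℚ n
ℕ→ℚ-+ m n = trans
  (ℚ.fromℚᵘ-cong {ℕ→ℚᵘ (m ℕ.+ n)} {ℕ→ℚᵘ m ℚᵘ.+ ℕ→ℚᵘ n} (*≡* (cong (ℤ._* ℤ.+ 1) +[m+n]≡m*1+n*1)))
  (fromℚᵘ-homo-+ (ℕ→ℚᵘ m) (ℕ→ℚᵘ n))
  where
  +[m+n]≡m*1+n*1 : ℤ.+ (m ℕ.+ n) ≡ ℤ.+ m ℤ.* ℤ.+ 1 ℤ.+ ℤ.+ n ℤ.* ℤ.+ 1
  +[m+n]≡m*1+n*1 = trans (ℤ.pos-+ m n)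
    (sym (cong₂ ℤ._+_ (ℤ.*-identityʳ (ℤ.+ m)) (ℤ.*-identityʳ (ℤ.+ n))))

ℕ→ℚ-* : ∀ m n → ℕ→ℚ (m ℕ.* n) ≡ ℕ→ℚ m * ℕ→ℚ n
ℕ→ℚ-* m n = trans
  (ℚ.fromℚᵘ-cong {ℕ→ℚᵘ (m ℕ.* n)} {ℕ→ℚᵘ m ℚᵘ.* ℕ→ℚᵘ n} (*≡* (cong (ℤ._* ℤ.+ 1) (ℤ.pos-* m n))))
  (fromℚᵘ-homo-* (ℕ→ℚᵘ m) (ℕ→ℚᵘ n))

ℕ→ℚ-suc : ∀ n → ℕ→ℚ (suc n) ≡ 1ℚ + ℕ→ℚ n
ℕ→ℚ-suc = ℕ→ℚ-+ 1

ℕ→ℚ-injective : ∀ {m n} → ℕ→ℚ m ≡ ℕ→ℚ n → m ≡ n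
ℕ→ℚ-injective {m} {n} eq with ℚ.fromℚᵘ-injective {ℕ→ℚᵘ m} {ℕ→ℚᵘ n} eq
... | *≡* m*1≡n*1 =
  ℤ.+-injective (trans (sym (ℤ.*-identityʳ (ℤ.+ m))) (trans m*1≡n*1 (ℤ.*-identityʳ (ℤ.+ n))))

ℕ→ℚ-suc-≢0 : ∀ n → ℕ→ℚ (suc n) ≢ 0ℚ
ℕ→ℚ-suc-≢0 n eq with ℕ→ℚ-injective {suc n} {0} eq
... | ()

1+ℕ→ℚ-≢0 : ∀ n → 1ℚ + ℕ→ℚ n ≢ 0ℚ
1+ℕ→ℚ-≢0 n = subst (_≢ 0ℚ) (ℕ→ℚ-suc n) (ℕ→ℚ-suc-≢0 n)

2ℚ 3ℚ 4ℚ 6ℚ 8ℚ : ℚ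
2ℚ = ℕ→ℚ 2
3ℚ = ℕ→ℚ 3
4ℚ = ℕ→ℚ 4
6ℚ = ℕ→ℚ 6
8ℚ = ℕ→ℚ 8

8ℚ≢0 : 8ℚ ≢ 0ℚ
8ℚ≢0 ()

*-cancelʳ-≢0 : ∀ {x y} z → z ≢ 0ℚ → x * z ≡ y * z → x ≡ y
*-cancelʳ-≢0 {x} {y} z z≢0 xz≡yz = begin
  x               ≡⟨ ℚ.*-identityʳ x ⟨
  x * 1ℚ          ≡⟨ cong (x *_) (ℚ.*-inverseʳ z) ⟨
  x * (z * 1/ z)  ≡⟨ ℚ.*-assoc x z (1/ z) ⟨
  x * z * 1/ z    ≡⟨ cong (_* 1/ z) xz≡yz ⟩
  y * z * 1/ z    ≡⟨ ℚ.*-assoc y z (1/ z) ⟩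
  y * (z * 1/ z)  ≡⟨ cong (y *_) (ℚ.*-inverseʳ z) ⟩
  y * 1ℚ          ≡⟨ ℚ.*-identityʳ y ⟩
  y               ∎
  where
  open ≡-Reasoning
  instance _ = ≢-nonZero z≢0

*-≢0 : ∀ {x y} → x ≢ 0ℚ → y ≢ 0ℚ → x * y ≢ 0ℚ
*-≢0 {x} {y} x≢0 y≢0 xy≡0 = x≢0 (*-cancelʳ-≢0 y y≢0 (trans xy≡0 (sym (ℚ.*-zeroˡ y))))

≢0-if-*≡ : ∀ {x c y} → x * c ≡ y → y ≢ 0ℚ → x ≢ 0ℚ
≢0-if-*≡ {c = c} xc≡y y≢0 x≡0 = y≢0 (trans (sym xc≡y) (trans (cong (_* c) x≡0) (ℚ.*-zeroˡ c)))

÷'-inverseʳ : ∀ x {y} → y ≢ 0ℚ → (x ÷' y) * y ≡ x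
÷'-inverseʳ x {y} y≢0 with y ℚ.≟ 0ℚ
... | yes y≡0 = contradiction y≡0 y≢0
... | no y≢0′ = begin
  x * 1/ y * y    ≡⟨ ℚ.*-assoc x (1/ y) y ⟩
  x * (1/ y * y)  ≡⟨ cong (x *_) (ℚ.*-inverseˡ y) ⟩
  x * 1ℚ          ≡⟨ ℚ.*-identityʳ x ⟩
  x               ∎
  where
  open ≡-Reasoning
  instance _ = ≢-nonZero y≢0′

0÷' : ∀ y → 0ℚ ÷' y ≡ 0ℚ
0÷' y with y ℚ.≟ 0ℚ
... | yes _ = refl
... | no y≢0 = ℚ.*-zeroˡ (1/_ y {{≢-nonZero y≢0}})

÷'-*-÷' : ∀ x z {y w} → y ≢ 0ℚ → w ≢ 0ℚ → (x ÷' y) * (z ÷' w) ≡ (x * z) ÷' (y * w)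
÷'-*-÷' x z {y} {w} y≢0 w≢0 = *-cancelʳ-≢0 (y * w) (*-≢0 y≢0 w≢0) (begin
  (x ÷' y) * (z ÷' w) * (y * w)
    ≡⟨ solve 4 (λ X Z y w → X :* Z :* (y :* w) := (X :* y) :* (Z :* w)) refl (x ÷' y) (z ÷' w) y w ⟩
  (x ÷' y) * y * ((z ÷' w) * w)
    ≡⟨ cong₂ _*_ (÷'-inverseʳ x y≢0) (÷'-inverseʳ z w≢0) ⟩
  x * z
    ≡⟨ ÷'-inverseʳ (x * z) (*-≢0 y≢0 w≢0) ⟨
  (x * z) ÷' (y * w) * (y * w) ∎)
  where open ≡-Reasoning

÷'-cross : ∀ {x y z w h r} → y ≢ 0ℚ → w ≢ 0ℚ →
           x * w * h ≡ z * y * r → (x ÷' y) * h ≡ (z ÷' w) * r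
÷'-cross {x} {y} {z} {w} {h} {r} y≢0 w≢0 eq = *-cancelʳ-≢0 (y * w) (*-≢0 y≢0 w≢0) (begin
  (x ÷' y) * h * (y * w)
    ≡⟨ solve 4 (λ X h y w → X :* h :* (y :* w) := X :* y :* w :* h) refl (x ÷' y) h y w ⟩
  (x ÷' y) * y * w * h
    ≡⟨ cong (λ t → t * w * h) (÷'-inverseʳ x y≢0) ⟩
  x * w * h
    ≡⟨ eq ⟩
  z * y * r
    ≡⟨ cong (λ t → t * y * r) (÷'-inverseʳ z w≢0) ⟨
  (z ÷' w) * w * y * r
    ≡⟨ solve 4 (λ Z w y r → Z :* w :* y :* r := Z :* r :* (y :* w)) refl (z ÷' w) w y r ⟩
  (z ÷' w) * r * (y * w) ∎)
  where open ≡-Reasoning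

-- Powers, rising factorials and finite sums

pow-≢0 : ∀ {x} → x ≢ 0ℚ → ∀ n → pow x n ≢ 0ℚ
pow-≢0 x≢0 zero = λ ()
pow-≢0 x≢0 (suc n) = *-≢0 (pow-≢0 x≢0 n) x≢0

pow-+ : ∀ x m n → pow x (m ℕ.+ n) ≡ pow x m * pow x n
pow-+ x m zero = trans (cong (pow x) (ℕ.+-identityʳ m)) (sym (ℚ.*-identityʳ (pow x m)))
pow-+ x m (suc n) = begin
  pow x (m ℕ.+ suc n)      ≡⟨ cong (pow x) (ℕ.+-suc m n) ⟩
  pow x (m ℕ.+ n) * x      ≡⟨ cong (_* x) (pow-+ x m n) ⟩
  pow x m * pow x n * x    ≡⟨ ℚ.*-assoc (pow x m) (pow x n) x ⟩
  pow x m * pow x (suc n)  ∎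
  where open ≡-Reasoning

pow-neg-one-even : ∀ n → pow (- 1ℚ) (2 ℕ.* n) ≡ 1ℚ
pow-neg-one-even zero = refl
pow-neg-one-even (suc n) = begin
  pow (- 1ℚ) (2 ℕ.* suc n)              ≡⟨ cong (pow (- 1ℚ)) (ℕ.*-suc 2 n) ⟩
  pow (- 1ℚ) (2 ℕ.* n) * - 1ℚ * - 1ℚ    ≡⟨ cong (λ t → t * - 1ℚ * - 1ℚ) (pow-neg-one-even n) ⟩
  1ℚ * - 1ℚ * - 1ℚ                      ≡⟨⟩
  1ℚ                                    ∎
  where open ≡-Reasoning

pow-neg-one-odd : ∀ n → pow (- 1ℚ) (suc (2 ℕ.* n)) ≡ - 1ℚ
pow-neg-one-odd n = cong (_* - 1ℚ) (pow-neg-one-even n)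

poch-≢0 : ∀ {x} → (∀ j → x + ℕ→ℚ j ≢ 0ℚ) → ∀ k → poch x k ≢ 0ℚ
poch-≢0 x+j≢0 zero = λ ()
poch-≢0 x+j≢0 (suc k) = *-≢0 (poch-≢0 x+j≢0 k) (x+j≢0 k)

poch-≡0 : ∀ {x j} k → x + ℕ→ℚ j ≡ 0ℚ → j ℕ.< k → poch x k ≡ 0ℚ
poch-≡0 {x} {j} (suc k) x+j≡0 j<1+k with ℕ.m<1+n⇒m<n∨m≡n j<1+k
... | inj₁ j<k  = trans (cong (_* (x + ℕ→ℚ k)) (poch-≡0 k x+j≡0 j<k)) (ℚ.*-zeroˡ (x + ℕ→ℚ k))
... | inj₂ refl = trans (cong (poch x j *_) x+j≡0) (ℚ.*-zeroʳ (poch x j))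

-- x (x + 1)_k = (x)_{k+1} = (x)_k (x + k)
poch-shift : ∀ x k → poch (x + 1ℚ) k * x ≡ poch x k * (x + ℕ→ℚ k)
poch-shift x zero = solve 1 (λ x → con 1ℚ :* x := con 1ℚ :* (x :+ con 0ℚ)) refl x
poch-shift x (suc k) = begin
  poch (x + 1ℚ) k * (x + 1ℚ + K) * x   ≡⟨ xy∙z≈xz∙y (poch (x + 1ℚ) k) (x + 1ℚ + K) x ⟩
  poch (x + 1ℚ) k * x * (x + 1ℚ + K)   ≡⟨ cong (_* (x + 1ℚ + K)) (poch-shift x k) ⟩
  poch x k * (x + K) * (x + 1ℚ + K)    ≡⟨ cong (poch x k * (x + K) *_) x+1+K≡x+[1+k] ⟩
  poch x (suc k) * (x + ℕ→ℚ (suc k))   ∎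
  where
  open ≡-Reasoning
  K = ℕ→ℚ k
  x+1+K≡x+[1+k] : x + 1ℚ + K ≡ x + ℕ→ℚ (suc k)
  x+1+K≡x+[1+k] = trans (ℚ.+-assoc x 1ℚ K) (cong (x +_) (sym (ℕ→ℚ-suc k)))

poch-shift₂ : ∀ x k → poch (x + 2ℚ) k * (x * (x + 1ℚ))
                      ≡ poch x k * ((x + ℕ→ℚ k) * (x + 1ℚ + ℕ→ℚ k))
poch-shift₂ x k = begin
  poch (x + 2ℚ) k * (x * (x + 1ℚ))         ≡⟨ cong (λ t → poch t k * (x * (x + 1ℚ))) x+2≡x+1+1 ⟩
  poch (x + 1ℚ + 1ℚ) k * (x * (x + 1ℚ))    ≡⟨ x∙yz≈xz∙y (poch (x + 1ℚ + 1ℚ) k) x (x + 1ℚ) ⟩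
  poch (x + 1ℚ + 1ℚ) k * (x + 1ℚ) * x      ≡⟨ cong (_* x) (poch-shift (x + 1ℚ) k) ⟩
  poch (x + 1ℚ) k * (x + 1ℚ + K) * x       ≡⟨ xy∙z≈xz∙y (poch (x + 1ℚ) k) (x + 1ℚ + K) x ⟩
  poch (x + 1ℚ) k * x * (x + 1ℚ + K)       ≡⟨ cong (_* (x + 1ℚ + K)) (poch-shift x k) ⟩
  poch x k * (x + K) * (x + 1ℚ + K)        ≡⟨ ℚ.*-assoc (poch x k) (x + K) (x + 1ℚ + K) ⟩
  poch x k * ((x + K) * (x + 1ℚ + K))      ∎
  where
  open ≡-Reasoning
  K = ℕ→ℚ k
  x+2≡x+1+1 : x + 2ℚ ≡ x + 1ℚ + 1ℚ
  x+2≡x+1+1 = solve 1 (λ x → x :+ con 2ℚ := x :+ con 1ℚ :+ con 1ℚ) refl x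

poch-shift⁻ : ∀ x k → poch x k * (x - 1ℚ) ≡ poch (x - 1ℚ) k * (x - 1ℚ + ℕ→ℚ k)
poch-shift⁻ x k = trans (cong (λ t → poch t k * (x - 1ℚ)) x≡x-1+1) (poch-shift (x - 1ℚ) k)
  where
  x≡x-1+1 : x ≡ x - 1ℚ + 1ℚ
  x≡x-1+1 = solve 1 (λ x → x := x :- con 1ℚ :+ con 1ℚ) refl x

sumTo-linear : ∀ u v f g n → sumTo n (λ k → u * f k + v * g k) ≡ u * sumTo n f + v * sumTo n g
sumTo-linear u v f g zero = refl
sumTo-linear u v f g (suc n) = begin
  sumTo n (λ k → u * f k + v * g k) + (u * f (suc n) + v * g (suc n))
    ≡⟨ cong (_+ (u * f (suc n) + v * g (suc n))) (sumTo-linear u v f g n) ⟩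
  u * sumTo n f + v * sumTo n g + (u * f (suc n) + v * g (suc n))
    ≡⟨ solve 6 (λ u v S T x y → u :* S :+ v :* T :+ (u :* x :+ v :* y) := u :* (S :+ x) :+ v :* (T :+ y))
         refl u v (sumTo n f) (sumTo n g) (f (suc n)) (g (suc n)) ⟩
  u * sumTo (suc n) f + v * sumTo (suc n) g ∎
  where open ≡-Reasoning

sumTo-telescope : ∀ (f g : ℕ → ℚ) → (∀ k → f k ≡ g (suc k) - g k) →
                  ∀ n → sumTo n f ≡ g (suc n) - g 0
sumTo-telescope f g f≡Δg zero = f≡Δg 0
sumTo-telescope f g f≡Δg (suc n) = begin
  sumTo n f + f (suc n)
    ≡⟨ cong₂ _+_ (sumTo-telescope f g f≡Δg n) (f≡Δg (suc n)) ⟩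
  (g (suc n) - g 0) + (g (suc (suc n)) - g (suc n))
    ≡⟨ solve 3 (λ a b c → (b :- a) :+ (c :- b) := c :- a) refl (g 0) (g (suc n)) (g (suc (suc n))) ⟩
  g (suc (suc n)) - g 0 ∎
  where open ≡-Reasoning

sumTo-vanishing-tail : ∀ {n} f → (∀ j → n ℕ.< j → f j ≡ 0ℚ) →
                       ∀ i → sumTo (i ℕ.+ n) f ≡ sumTo n f
sumTo-vanishing-tail f f≡0 zero = refl
sumTo-vanishing-tail {n} f f≡0 (suc i) = begin
  sumTo (i ℕ.+ n) f + f (suc (i ℕ.+ n))
    ≡⟨ cong₂ _+_ (sumTo-vanishing-tail f f≡0 i) (f≡0 _ (ℕ.s≤s (ℕ.m≤n+m n i))) ⟩
  sumTo n f + 0ℚ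
    ≡⟨ ℚ.+-identityʳ (sumTo n f) ⟩
  sumTo n f ∎
  where open ≡-Reasoning

-- The hypergeometric term and its contiguous relations

hypNum : ℚ → ℚ → ℕ → ℚ
hypNum a c k = poch ½ k * poch a k * poch c k * pow (- 1ℚ) k

hypDen : ℚ → ℚ → ℕ → ℚ
hypDen d e k = poch 1ℚ k * poch d k * poch e k * pow 8ℚ k

hyp : ℚ → ℚ → ℚ → ℚ → ℕ → ℚ
hyp a c d e k = hypNum a c k ÷' hypDen d e k

hyp-cong : ∀ {a a′ c c′ d d′ e e′} k → a ≡ a′ → c ≡ c′ → d ≡ d′ → e ≡ e′ →
           hyp a c d e k ≡ hyp a′ c′ d′ e′ k
hyp-cong k refl refl refl refl = refl

hypDen-≢0 : ∀ {d e} → (∀ j → d + ℕ→ℚ j ≢ 0ℚ) → (∀ j → e + ℕ→ℚ j ≢ 0ℚ) →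
            ∀ k → hypDen d e k ≢ 0ℚ
hypDen-≢0 d+j≢0 e+j≢0 k =
  *-≢0 (*-≢0 (*-≢0 (poch-≢0 1+ℕ→ℚ-≢0 k) (poch-≢0 d+j≢0 k)) (poch-≢0 e+j≢0 k)) (pow-≢0 8ℚ≢0 k)

hyp-≡0 : ∀ a c d e k → poch a k ≡ 0ℚ → hyp a c d e k ≡ 0ℚ
hyp-≡0 a c d e k [a]ₖ≡0 = trans (cong (_÷' hypDen d e k) num≡0) (0÷' (hypDen d e k))
  where
  num≡0 : hypNum a c k ≡ 0ℚ
  num≡0 = trans (cong (λ t → poch ½ k * t * poch c k * pow (- 1ℚ) k) [a]ₖ≡0)
                (solve 3 (λ x y z → x :* con 0ℚ :* y :* z := con 0ℚ)
                       refl (poch ½ k) (poch c k) (pow (- 1ℚ) k))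

hyp-raise-a : ∀ a c d e k → hypDen d e k ≢ 0ℚ →
  hyp (a + 2ℚ) c d e k * (a * (a + 1ℚ)) ≡ hyp a c d e k * ((a + ℕ→ℚ k) * (a + 1ℚ + ℕ→ℚ k))
hyp-raise-a a c d e k D≢0 = ÷'-cross D≢0 D≢0 (begin
  ½ₖ * poch (a + 2ℚ) k * cₖ * σ * D * (a * (a + 1ℚ))
    ≡⟨ solve 6 (λ h U c σ D x → h :* U :* c :* σ :* D :* x := U :* x :* (h :* c :* σ :* D))
         refl ½ₖ (poch (a + 2ℚ) k) cₖ σ D (a * (a + 1ℚ)) ⟩
  poch (a + 2ℚ) k * (a * (a + 1ℚ)) * (½ₖ * cₖ * σ * D)
    ≡⟨ cong (_* (½ₖ * cₖ * σ * D)) (poch-shift₂ a k) ⟩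
  poch a k * ((a + K) * (a + 1ℚ + K)) * (½ₖ * cₖ * σ * D)
    ≡⟨ solve 6 (λ h U c σ D x → U :* x :* (h :* c :* σ :* D) := h :* U :* c :* σ :* D :* x)
         refl ½ₖ (poch a k) cₖ σ D ((a + K) * (a + 1ℚ + K)) ⟩
  ½ₖ * poch a k * cₖ * σ * D * ((a + K) * (a + 1ℚ + K)) ∎)
  where
  open ≡-Reasoning
  K = ℕ→ℚ k
  ½ₖ = poch ½ k
  cₖ = poch c k
  σ = pow (- 1ℚ) k
  D = hypDen d e k

hyp-raise-cde : ∀ a c d e k → hypDen d e k ≢ 0ℚ → hypDen (d + 1ℚ) (e - 1ℚ) k ≢ 0ℚ →
  let K = ℕ→ℚ k in
  hyp a (c + 2ℚ) (d + 1ℚ) (e - 1ℚ) k * (c * (c + 1ℚ) * (d + K) * (e - 1ℚ))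
    ≡ hyp a c d e k * ((c + K) * (c + 1ℚ + K) * d * (e - 1ℚ + K))
hyp-raise-cde a c d e k D≢0 D′≢0 = ÷'-cross D′≢0 D≢0 (begin
  ½ₖ * aₖ * poch (c + 2ℚ) k * σ * (1ₖ * dₖ * eₖ * τ) * (c * (c + 1ℚ) * (d + K) * (e - 1ℚ))
    ≡⟨ solve 12 (λ h A C σ o D E τ c d e K →
         h :* A :* C :* σ :* (o :* D :* E :* τ) :* (c :* (c :+ con 1ℚ) :* (d :+ K) :* (e :- con 1ℚ))
         := C :* (c :* (c :+ con 1ℚ)) :* (D :* (d :+ K)) :* (E :* (e :- con 1ℚ)) :* (h :* A :* σ :* o :* τ))
         refl ½ₖ aₖ (poch (c + 2ℚ) k) σ 1ₖ dₖ eₖ τ c d e K ⟩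
  poch (c + 2ℚ) k * (c * (c + 1ℚ)) * (dₖ * (d + K)) * (eₖ * (e - 1ℚ)) * M
    ≡⟨ cong₂ (λ x y → x * y * (eₖ * (e - 1ℚ)) * M) (poch-shift₂ c k) (sym (poch-shift d k)) ⟩
  cₖ * ((c + K) * (c + 1ℚ + K)) * (d₁ₖ * d) * (eₖ * (e - 1ℚ)) * M
    ≡⟨ cong (λ x → cₖ * ((c + K) * (c + 1ℚ + K)) * (d₁ₖ * d) * x * M) (poch-shift⁻ e k) ⟩
  cₖ * ((c + K) * (c + 1ℚ + K)) * (d₁ₖ * d) * (e₁ₖ * (e - 1ℚ + K)) * M
    ≡⟨ solve 12 (λ h A C σ o D E τ c d e K →
         C :* ((c :+ K) :* (c :+ con 1ℚ :+ K)) :* (D :* d) :* (E :* (e :- con 1ℚ :+ K))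
           :* (h :* A :* σ :* o :* τ)
         := h :* A :* C :* σ :* (o :* D :* E :* τ)
           :* ((c :+ K) :* (c :+ con 1ℚ :+ K) :* d :* (e :- con 1ℚ :+ K)))
         refl ½ₖ aₖ cₖ σ 1ₖ d₁ₖ e₁ₖ τ c d e K ⟩
  ½ₖ * aₖ * cₖ * σ * (1ₖ * d₁ₖ * e₁ₖ * τ) * ((c + K) * (c + 1ℚ + K) * d * (e - 1ℚ + K)) ∎)
  where
  open ≡-Reasoning
  K = ℕ→ℚ k
  ½ₖ = poch ½ k
  aₖ = poch a k
  cₖ = poch c k
  dₖ = poch d k
  eₖ = poch e k
  d₁ₖ = poch (d + 1ℚ) k
  e₁ₖ = poch (e - 1ℚ) k
  1ₖ = poch 1ℚ k
  σ = pow (- 1ℚ) k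
  τ = pow 8ℚ k
  M = ½ₖ * aₖ * σ * 1ₖ * τ

hyp-suc : ∀ a c d e k → hypDen d e k ≢ 0ℚ → hypDen d e (suc k) ≢ 0ℚ →
  let K = ℕ→ℚ k in
  hyp a c d e (suc k) * (8ℚ * (1ℚ + K) * (d + K) * (e + K))
    ≡ hyp a c d e k * (- ((½ + K) * (a + K) * (c + K)))
hyp-suc a c d e k D≢0 D⁺≢0 = ÷'-cross D⁺≢0 D≢0
  (solve 13 (λ h A C σ o D E τ a c d e K →
     (h :* (con ½ :+ K)) :* (A :* (a :+ K)) :* (C :* (c :+ K)) :* (σ :* (:- con 1ℚ))
       :* (o :* D :* E :* τ) :* (con 8ℚ :* (con 1ℚ :+ K) :* (d :+ K) :* (e :+ K))
     := h :* A :* C :* σ :* ((o :* (con 1ℚ :+ K)) :* (D :* (d :+ K)) :* (E :* (e :+ K)) :* (τ :* con 8ℚ))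
       :* (:- ((con ½ :+ K) :* (a :+ K) :* (c :+ K))))
   refl (poch ½ k) (poch a k) (poch c k) (pow (- 1ℚ) k) (poch 1ℚ k) (poch d k) (poch e k) (pow 8ℚ k)
        a c d e (ℕ→ℚ k))

-- The WZ pair

a⁻ a⁺ b⁺ b⁻ : ℚ → ℚ
a⁻ q = ½ - q * ½
a⁺ q = ½ + q * ½
b⁺ q = 1ℚ + q * (ℤ.+ 1 / 4)
b⁻ q = 1ℚ - q * (ℤ.+ 1 / 4)

module ParameterSyntax {n : ℕ} where
  a⁻ₑ a⁺ₑ b⁺ₑ b⁻ₑ : Polynomial n → Polynomial n
  a⁻ₑ q = con ½ :- q :* con ½
  a⁺ₑ q = con ½ :+ q :* con ½
  b⁺ₑ q = con 1ℚ :+ q :* con (ℤ.+ 1 / 4)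
  b⁻ₑ q = con 1ℚ :- q :* con (ℤ.+ 1 / 4)

open ParameterSyntax

summand≡hyp : ∀ p k → let q = ℕ→ℚ p in
  (∀ j → b⁺ q + ℕ→ℚ j ≢ 0ℚ) → (∀ j → b⁻ q + ℕ→ℚ j ≢ 0ℚ) →
  summand p k ≡ (6ℚ * ℕ→ℚ k + 1ℚ) * hyp (a⁻ q) (a⁺ q) (b⁺ q) (b⁻ q) k
summand≡hyp p k d+j≢0 e+j≢0 = begin
  s * (N ÷' Y) * (pow (- 1ℚ) k ÷' pow 8ℚ k)
    ≡⟨ ℚ.*-assoc s (N ÷' Y) _ ⟩
  s * ((N ÷' Y) * (pow (- 1ℚ) k ÷' pow 8ℚ k))
    ≡⟨ cong₂ _*_ (cong (_+ 1ℚ) (ℕ→ℚ-* 6 k)) (÷'-*-÷' N (pow (- 1ℚ) k) Y≢0 (pow-≢0 8ℚ≢0 k)) ⟩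
  (6ℚ * ℕ→ℚ k + 1ℚ) * hyp (a⁻ q) (a⁺ q) (b⁺ q) (b⁻ q) k ∎
  where
  open ≡-Reasoning
  q = ℕ→ℚ p
  s = ℕ→ℚ (6 ℕ.* k) + 1ℚ
  N = poch ½ k * poch (a⁻ q) k * poch (a⁺ q) k
  Y = poch 1ℚ k * poch (b⁺ q) k * poch (b⁻ q) k
  Y≢0 : Y ≢ 0ℚ
  Y≢0 Y≡0 = hypDen-≢0 d+j≢0 e+j≢0 k (trans (cong (_* pow 8ℚ k) Y≡0) (ℚ.*-zeroˡ (pow 8ℚ k)))

wzFactor : ℚ → ℚ
wzFactor q = (q + 1ℚ) * (q + 3ℚ)

wzMultiplier : ℚ → ℚ → ℚ
wzMultiplier q x = (- 8ℚ) * (q + 2ℚ) * (q + 4ℚ) * x * (q - 4ℚ * x)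

wzMultiplier-0 : ∀ q → wzMultiplier q 0ℚ ≡ 0ℚ
wzMultiplier-0 q = trans (cong (_* (q - 4ℚ * 0ℚ)) (ℚ.*-zeroʳ ((- 8ℚ) * (q + 2ℚ) * (q + 4ℚ))))
                         (ℚ.*-zeroˡ (q - 4ℚ * 0ℚ))

-- The rational-function identity behind the WZ pair, cleared of denominators:
-- h₁, h₂, h₃ and r₁, r₂, r₃ are the factors of hyp-raise-a, hyp-raise-cde and hyp-suc.
wz-certificate : ∀ q K →
  let α = a⁻ q - 2ℚ ; c = a⁺ q ; d = b⁺ q ; e = b⁻ q ; s = 6ℚ * K + 1ℚ
      h₁ = α * (α + 1ℚ)
      h₂ = c * (c + 1ℚ) * (d + K) * (e - 1ℚ)
      h₃ = 8ℚ * (1ℚ + K) * (d + K) * (e + K)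
      r₁ = s * ((α + K) * (α + 1ℚ + K))
      r₂ = s * ((c + K) * (c + 1ℚ + K) * d * (e - 1ℚ + K))
      r₃ = - ((½ + K) * (α + K) * (c + K))
  in wzFactor q * q * r₂ * (h₁ * h₃) + wzFactor q * (q + 4ℚ) * r₁ * (h₂ * h₃)
       ≡ wzMultiplier q (1ℚ + K) * r₃ * (h₁ * h₂) - wzMultiplier q K * (h₁ * h₂ * h₃)
wz-certificate = solve 2 (λ q K →
  let α = a⁻ₑ q :- con 2ℚ ; c = a⁺ₑ q ; d = b⁺ₑ q ; e = b⁻ₑ q ; s = con 6ℚ :* K :+ con 1ℚ
      h₁ = α :* (α :+ con 1ℚ)
      h₂ = c :* (c :+ con 1ℚ) :* (d :+ K) :* (e :- con 1ℚ)
      h₃ = con 8ℚ :* (con 1ℚ :+ K) :* (d :+ K) :* (e :+ K)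
      r₁ = s :* ((α :+ K) :* (α :+ con 1ℚ :+ K))
      r₂ = s :* ((c :+ K) :* (c :+ con 1ℚ :+ K) :* d :* (e :- con 1ℚ :+ K))
      r₃ = :- ((con ½ :+ K) :* (α :+ K) :* (c :+ K))
      Z = (q :+ con 1ℚ) :* (q :+ con 3ℚ)
      R = λ x → (:- con 8ℚ) :* (q :+ con 2ℚ) :* (q :+ con 4ℚ) :* x :* (q :- con 4ℚ :* x)
  in Z :* q :* r₂ :* (h₁ :* h₃) :+ Z :* (q :+ con 4ℚ) :* r₁ :* (h₂ :* h₃)
       := R (con 1ℚ :+ K) :* r₃ :* (h₁ :* h₂) :- R K :* (h₁ :* h₂ :* h₃)) refl

contiguity⇒wz : ∀ {F F′ B B⁺ h₁ h₂ h₃ r₁ r₂ r₃ u v w w⁺} → h₁ * h₂ * h₃ ≢ 0ℚ →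
  F * h₁ ≡ B * r₁ → F′ * h₂ ≡ B * r₂ → B⁺ * h₃ ≡ B * r₃ →
  u * r₂ * (h₁ * h₃) + v * r₁ * (h₂ * h₃) ≡ w⁺ * r₃ * (h₁ * h₂) - w * (h₁ * h₂ * h₃) →
  u * F′ + v * F ≡ w⁺ * B⁺ - w * B
contiguity⇒wz {F} {F′} {B} {B⁺} {h₁} {h₂} {h₃} {r₁} {r₂} {r₃} {u} {v} {w} {w⁺}
              H≢0 F-rel F′-rel B⁺-rel certificate =
  *-cancelʳ-≢0 (h₁ * h₂ * h₃) H≢0 (begin
    (u * F′ + v * F) * (h₁ * h₂ * h₃)
      ≡⟨ solve 7 (λ u v F′ F h₁ h₂ h₃ → (u :* F′ :+ v :* F) :* (h₁ :* h₂ :* h₃)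
                    := u :* (F′ :* h₂) :* (h₁ :* h₃) :+ v :* (F :* h₁) :* (h₂ :* h₃))
           refl u v F′ F h₁ h₂ h₃ ⟩
    u * (F′ * h₂) * (h₁ * h₃) + v * (F * h₁) * (h₂ * h₃)
      ≡⟨ cong₂ (λ x y → u * x * (h₁ * h₃) + v * y * (h₂ * h₃)) F′-rel F-rel ⟩
    u * (B * r₂) * (h₁ * h₃) + v * (B * r₁) * (h₂ * h₃)
      ≡⟨ solve 8 (λ u v B r₁ r₂ h₁ h₂ h₃ → u :* (B :* r₂) :* (h₁ :* h₃) :+ v :* (B :* r₁) :* (h₂ :* h₃)
                    := B :* (u :* r₂ :* (h₁ :* h₃) :+ v :* r₁ :* (h₂ :* h₃)))
           refl u v B r₁ r₂ h₁ h₂ h₃ ⟩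
    B * (u * r₂ * (h₁ * h₃) + v * r₁ * (h₂ * h₃))
      ≡⟨ cong (B *_) certificate ⟩
    B * (w⁺ * r₃ * (h₁ * h₂) - w * (h₁ * h₂ * h₃))
      ≡⟨ solve 7 (λ B r₃ w w⁺ h₁ h₂ h₃ → B :* (w⁺ :* r₃ :* (h₁ :* h₂) :- w :* (h₁ :* h₂ :* h₃))
                    := w⁺ :* (B :* r₃) :* (h₁ :* h₂) :- w :* B :* (h₁ :* h₂ :* h₃))
           refl B r₃ w w⁺ h₁ h₂ h₃ ⟩
    w⁺ * (B * r₃) * (h₁ * h₂) - w * B * (h₁ * h₂ * h₃)
      ≡⟨ cong (λ x → w⁺ * x * (h₁ * h₂) - w * B * (h₁ * h₂ * h₃)) B⁺-rel ⟨
    w⁺ * (B⁺ * h₃) * (h₁ * h₂) - w * B * (h₁ * h₂ * h₃)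
      ≡⟨ solve 7 (λ B B⁺ w w⁺ h₁ h₂ h₃ → w⁺ :* (B⁺ :* h₃) :* (h₁ :* h₂) :- w :* B :* (h₁ :* h₂ :* h₃)
                    := (w⁺ :* B⁺ :- w :* B) :* (h₁ :* h₂ :* h₃)) refl B B⁺ w w⁺ h₁ h₂ h₃ ⟩
    (w⁺ * B⁺ - w * B) * (h₁ * h₂ * h₃) ∎)
  where open ≡-Reasoning

-- From p to p + 4

signExponent : ℕ → ℕ
signExponent p = (p ℕ.* p ∸ 1) ℕ./ 8 ℕ.+ (p ∸ 1) ℕ./ 2

SumIdentity : ℕ → Set
SumIdentity p = sumTo ((p ∸ 1) ℕ./ 2) (summand p) ≡ pow (- 1ℚ) (signExponent p) * ℕ→ℚ p

half-double : ∀ m → (2 ℕ.* m) ℕ./ 2 ≡ m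
half-double m = trans (cong (ℕ._/ 2) (ℕ.*-comm 2 m)) (m*n/n≡m m 2)

next-odd : ∀ m → suc (2 ℕ.* (2 ℕ.+ m)) ≡ suc (2 ℕ.* m) ℕ.+ 4
next-odd = solve-∀

signExponent-step : ∀ m → signExponent (suc (2 ℕ.* (2 ℕ.+ m)))
                          ≡ signExponent (suc (2 ℕ.* m)) ℕ.+ suc (2 ℕ.* (2 ℕ.+ m))
signExponent-step m = begin
  (x′ ℕ.+ x′ ℕ.* suc x′) ℕ./ 8 ℕ.+ x′ ℕ./ 2
    ≡⟨ cong₂ ℕ._+_ (cong (ℕ._/ 8) (square-step m)) (half-double (2 ℕ.+ m)) ⟩
  (y ℕ.+ (3 ℕ.+ x) ℕ.* 8) ℕ./ 8 ℕ.+ (2 ℕ.+ m)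
    ≡⟨ cong (ℕ._+ (2 ℕ.+ m)) (+-distrib-/-∣ʳ y (divides-refl (3 ℕ.+ x))) ⟩
  y ℕ./ 8 ℕ.+ (3 ℕ.+ x) ℕ.* 8 ℕ./ 8 ℕ.+ (2 ℕ.+ m)
    ≡⟨ cong (λ t → y ℕ./ 8 ℕ.+ t ℕ.+ (2 ℕ.+ m)) (m*n/n≡m (3 ℕ.+ x) 8) ⟩
  y ℕ./ 8 ℕ.+ (3 ℕ.+ x) ℕ.+ (2 ℕ.+ m)
    ≡⟨ regroup (y ℕ./ 8) m ⟩
  y ℕ./ 8 ℕ.+ m ℕ.+ suc x′
    ≡⟨ cong (λ t → y ℕ./ 8 ℕ.+ t ℕ.+ suc x′) (half-double m) ⟨
  y ℕ./ 8 ℕ.+ x ℕ./ 2 ℕ.+ suc x′ ∎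
  where
  open ≡-Reasoning
  x = 2 ℕ.* m
  x′ = 2 ℕ.* (2 ℕ.+ m)
  y = x ℕ.+ x ℕ.* suc x
  square-step : ∀ m → let x = 2 ℕ.* m ; x′ = 2 ℕ.* (2 ℕ.+ m) in
                x′ ℕ.+ x′ ℕ.* suc x′ ≡ x ℕ.+ x ℕ.* suc x ℕ.+ (3 ℕ.+ x) ℕ.* 8
  square-step = solve-∀
  regroup : ∀ a m → a ℕ.+ (3 ℕ.+ 2 ℕ.* m) ℕ.+ (2 ℕ.+ m) ≡ a ℕ.+ m ℕ.+ suc (2 ℕ.* (2 ℕ.+ m))
  regroup = solve-∀

module OddStep (m : ℕ) where

  p p′ : ℕ
  p  = suc (2 ℕ.* m)
  p′ = suc (2 ℕ.* (2 ℕ.+ m))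

  q M : ℚ
  q = ℕ→ℚ p
  M = ℕ→ℚ m

  q≡1+2M : q ≡ 1ℚ + 2ℚ * M
  q≡1+2M = trans (ℕ→ℚ-suc (2 ℕ.* m)) (cong (1ℚ +_) (ℕ→ℚ-* 2 m))

  q′≡q+4 : ℕ→ℚ p′ ≡ q + 4ℚ
  q′≡q+4 = trans (cong ℕ→ℚ (next-odd m)) (ℕ→ℚ-+ p 4)

  q≢0 : q ≢ 0ℚ
  q≢0 = ℕ→ℚ-suc-≢0 (2 ℕ.* m)

  q+n≢0 : ∀ n → q + ℕ→ℚ n ≢ 0ℚ
  q+n≢0 n = subst (_≢ 0ℚ) (ℕ→ℚ-+ p n) (ℕ→ℚ-suc-≢0 (2 ℕ.* m ℕ.+ n))

  4n-q≢0 : ∀ n → 4ℚ * ℕ→ℚ n - q ≢ 0ℚ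
  4n-q≢0 n 4n-q≡0 = ℕ.even≢odd (2 ℕ.* n) m (ℕ→ℚ-injective (begin
    ℕ→ℚ (2 ℕ.* (2 ℕ.* n))  ≡⟨ cong ℕ→ℚ (ℕ.*-assoc 2 2 n) ⟨
    ℕ→ℚ (4 ℕ.* n)          ≡⟨ ℕ→ℚ-* 4 n ⟩
    4ℚ * ℕ→ℚ n             ≡⟨ x∙y⁻¹≈ε⇒x≈y (4ℚ * ℕ→ℚ n) q 4n-q≡0 ⟩
    q                      ∎))
    where open ≡-Reasoning

  4[1+n] : ∀ n → 4ℚ * (1ℚ + ℕ→ℚ n) ≡ ℕ→ℚ (4 ℕ.* suc n)
  4[1+n] n = sym (trans (ℕ→ℚ-* 4 (suc n)) (cong (4ℚ *_) (ℕ→ℚ-suc n)))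

  α c d e : ℚ
  α = a⁻ q - 2ℚ
  c = a⁺ q
  d = b⁺ q
  e = b⁻ q

  d+j≢0 : ∀ j → d + ℕ→ℚ j ≢ 0ℚ
  d+j≢0 j = ≢0-if-*≡
    (trans (solve 2 (λ q J → (b⁺ₑ q :+ J) :* con 4ℚ := q :+ con 4ℚ :* (con 1ℚ :+ J)) refl q (ℕ→ℚ j))
           (cong (q +_) (4[1+n] j)))
    (q+n≢0 (4 ℕ.* suc j))

  d+1+j≢0 : ∀ j → d + 1ℚ + ℕ→ℚ j ≢ 0ℚ
  d+1+j≢0 j = subst (_≢ 0ℚ) d+[1+j]≡d+1+j (d+j≢0 (suc j))
    where
    d+[1+j]≡d+1+j : d + ℕ→ℚ (suc j) ≡ d + 1ℚ + ℕ→ℚ j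
    d+[1+j]≡d+1+j = sym (trans (ℚ.+-assoc d 1ℚ (ℕ→ℚ j)) (cong (d +_) (sym (ℕ→ℚ-suc j))))

  e+j≢0 : ∀ j → e + ℕ→ℚ j ≢ 0ℚ
  e+j≢0 j = ≢0-if-*≡
    (trans (solve 2 (λ q J → (b⁻ₑ q :+ J) :* con 4ℚ := con 4ℚ :* (con 1ℚ :+ J) :- q) refl q (ℕ→ℚ j))
           (cong (_- q) (trans (4[1+n] j) (ℕ→ℚ-* 4 (suc j)))))
    (4n-q≢0 (suc j))

  e-1+j≢0 : ∀ j → e - 1ℚ + ℕ→ℚ j ≢ 0ℚ
  e-1+j≢0 j = ≢0-if-*≡
    (solve 2 (λ q J → (b⁻ₑ q :- con 1ℚ :+ J) :* con 4ℚ := con 4ℚ :* J :- q) refl q (ℕ→ℚ j))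
    (4n-q≢0 j)

  α≢0 : α ≢ 0ℚ
  α≢0 = ≢0-if-*≡ (solve 1 (λ q → (a⁻ₑ q :- con 2ℚ) :* (:- con 2ℚ) := q :+ con 3ℚ) refl q) (q+n≢0 3)

  α+1≢0 : α + 1ℚ ≢ 0ℚ
  α+1≢0 = ≢0-if-*≡
    (solve 1 (λ q → (a⁻ₑ q :- con 2ℚ :+ con 1ℚ) :* (:- con 2ℚ) := q :+ con 1ℚ) refl q) (q+n≢0 1)

  c≢0 : c ≢ 0ℚ
  c≢0 = ≢0-if-*≡ (solve 1 (λ q → a⁺ₑ q :* con 2ℚ := q :+ con 1ℚ) refl q) (q+n≢0 1)

  c+1≢0 : c + 1ℚ ≢ 0ℚ
  c+1≢0 = ≢0-if-*≡ (solve 1 (λ q → (a⁺ₑ q :+ con 1ℚ) :* con 2ℚ := q :+ con 3ℚ) refl q) (q+n≢0 3)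

  e-1≢0 : e - 1ℚ ≢ 0ℚ
  e-1≢0 = ≢0-if-*≡ (solve 1 (λ q → (b⁻ₑ q :- con 1ℚ) :* (:- con 4ℚ) := q) refl q) q≢0

  wzFactor≢0 : wzFactor q ≢ 0ℚ
  wzFactor≢0 = *-≢0 (q+n≢0 1) (q+n≢0 3)

  D≢0 : ∀ k → hypDen d e k ≢ 0ℚ
  D≢0 = hypDen-≢0 d+j≢0 e+j≢0

  D′≢0 : ∀ k → hypDen (d + 1ℚ) (e - 1ℚ) k ≢ 0ℚ
  D′≢0 = hypDen-≢0 d+1+j≢0 e-1+j≢0

  B G : ℕ → ℚ
  B = hyp α c d e
  G k = wzMultiplier q (ℕ→ℚ k) * B k

  F-contiguity : ∀ k → let K = ℕ→ℚ k ; s = 6ℚ * K + 1ℚ in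
    summand p k * (α * (α + 1ℚ)) ≡ B k * (s * ((α + K) * (α + 1ℚ + K)))
  F-contiguity k = begin
    summand p k * h                          ≡⟨ cong (_* h) (summand≡hyp p k d+j≢0 e+j≢0) ⟩
    s * hyp (a⁻ q) c d e k * h               ≡⟨ cong (λ t → s * t * h) (hyp-cong k a⁻q≡α+2 refl refl refl) ⟩
    s * hyp (α + 2ℚ) c d e k * h             ≡⟨ ℚ.*-assoc s _ h ⟩
    s * (hyp (α + 2ℚ) c d e k * h)           ≡⟨ cong (s *_) (hyp-raise-a α c d e k (D≢0 k)) ⟩
    s * (B k * r)                            ≡⟨ x∙yz≈y∙xz s (B k) r ⟩
    B k * (s * r)                            ∎
    where
    open ≡-Reasoning
    K = ℕ→ℚ k
    s = 6ℚ * K + 1ℚ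
    h = α * (α + 1ℚ)
    r = (α + K) * (α + 1ℚ + K)
    a⁻q≡α+2 : a⁻ q ≡ α + 2ℚ
    a⁻q≡α+2 = solve 1 (λ q → a⁻ₑ q := a⁻ₑ q :- con 2ℚ :+ con 2ℚ) refl q

  F′-contiguity : ∀ k → let K = ℕ→ℚ k ; s = 6ℚ * K + 1ℚ in
    summand p′ k * (c * (c + 1ℚ) * (d + K) * (e - 1ℚ))
      ≡ B k * (s * ((c + K) * (c + 1ℚ + K) * d * (e - 1ℚ + K)))
  F′-contiguity k = begin
    summand p′ k * h
      ≡⟨ cong (_* h) (summand≡hyp p′ k d′+j≢0 e′+j≢0) ⟩
    s * hyp (a⁻ q′) (a⁺ q′) (b⁺ q′) (b⁻ q′) k * h
      ≡⟨ cong (λ t → s * t * h) (hyp-cong k shift-a shift-c shift-d shift-e) ⟩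
    s * hyp α (c + 2ℚ) (d + 1ℚ) (e - 1ℚ) k * h
      ≡⟨ ℚ.*-assoc s _ h ⟩
    s * (hyp α (c + 2ℚ) (d + 1ℚ) (e - 1ℚ) k * h)
      ≡⟨ cong (s *_) (hyp-raise-cde α c d e k (D≢0 k) (D′≢0 k)) ⟩
    s * (B k * r)
      ≡⟨ x∙yz≈y∙xz s (B k) r ⟩
    B k * (s * r) ∎
    where
    open ≡-Reasoning
    K = ℕ→ℚ k
    s = 6ℚ * K + 1ℚ
    h = c * (c + 1ℚ) * (d + K) * (e - 1ℚ)
    r = (c + K) * (c + 1ℚ + K) * d * (e - 1ℚ + K)
    q′ = ℕ→ℚ p′
    shift-a : a⁻ q′ ≡ α
    shift-a = trans (cong a⁻ q′≡q+4) (solve 1 (λ q → a⁻ₑ (q :+ con 4ℚ) := a⁻ₑ q :- con 2ℚ) refl q)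
    shift-c : a⁺ q′ ≡ c + 2ℚ
    shift-c = trans (cong a⁺ q′≡q+4) (solve 1 (λ q → a⁺ₑ (q :+ con 4ℚ) := a⁺ₑ q :+ con 2ℚ) refl q)
    shift-d : b⁺ q′ ≡ d + 1ℚ
    shift-d = trans (cong b⁺ q′≡q+4) (solve 1 (λ q → b⁺ₑ (q :+ con 4ℚ) := b⁺ₑ q :+ con 1ℚ) refl q)
    shift-e : b⁻ q′ ≡ e - 1ℚ
    shift-e = trans (cong b⁻ q′≡q+4) (solve 1 (λ q → b⁻ₑ (q :+ con 4ℚ) := b⁻ₑ q :- con 1ℚ) refl q)
    d′+j≢0 : ∀ j → b⁺ q′ + ℕ→ℚ j ≢ 0ℚ
    d′+j≢0 = subst (λ t → ∀ j → t + ℕ→ℚ j ≢ 0ℚ) (sym shift-d) d+1+j≢0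
    e′+j≢0 : ∀ j → b⁻ q′ + ℕ→ℚ j ≢ 0ℚ
    e′+j≢0 = subst (λ t → ∀ j → t + ℕ→ℚ j ≢ 0ℚ) (sym shift-e) e-1+j≢0

  H≢0 : ∀ k → let K = ℕ→ℚ k in
    α * (α + 1ℚ) * (c * (c + 1ℚ) * (d + K) * (e - 1ℚ)) * (8ℚ * (1ℚ + K) * (d + K) * (e + K)) ≢ 0ℚ
  H≢0 k = *-≢0 (*-≢0 (*-≢0 α≢0 α+1≢0)
                      (*-≢0 (*-≢0 (*-≢0 c≢0 c+1≢0) (d+j≢0 k)) e-1≢0))
                (*-≢0 (*-≢0 (*-≢0 8ℚ≢0 (1+ℕ→ℚ-≢0 k)) (d+j≢0 k)) (e+j≢0 k))

  wz-pair : ∀ k →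
    wzFactor q * q * summand p′ k + wzFactor q * (q + 4ℚ) * summand p k ≡ G (suc k) - G k
  wz-pair k = trans
    (contiguity⇒wz {u = wzFactor q * q} {v = wzFactor q * (q + 4ℚ)}
                   {w = wzMultiplier q (ℕ→ℚ k)} {w⁺ = wzMultiplier q (1ℚ + ℕ→ℚ k)}
                   (H≢0 k) (F-contiguity k) (F′-contiguity k)
                   (hyp-suc α c d e k (D≢0 k) (D≢0 (suc k))) (wz-certificate q (ℕ→ℚ k)))
    (cong (λ x → wzMultiplier q x * B (suc k) - G k) (sym (ℕ→ℚ-suc k)))

  a⁻q+m≡0 : a⁻ q + M ≡ 0ℚ
  a⁻q+m≡0 = trans (cong (λ t → a⁻ t + M) q≡1+2M)
                  (solve 1 (λ M → a⁻ₑ (con 1ℚ :+ con 2ℚ :* M) :+ M := con 0ℚ) refl M)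

  α+[2+m]≡0 : α + ℕ→ℚ (2 ℕ.+ m) ≡ 0ℚ
  α+[2+m]≡0 = trans (cong₂ (λ t u → a⁻ t - 2ℚ + u) q≡1+2M (ℕ→ℚ-+ 2 m))
                    (solve 1 (λ M → a⁻ₑ (con 1ℚ :+ con 2ℚ :* M) :- con 2ℚ :+ (con 2ℚ :+ M) := con 0ℚ)
                           refl M)

  summand-vanishes : ∀ k → m ℕ.< k → summand p k ≡ 0ℚ
  summand-vanishes k m<k = begin
    summand p k               ≡⟨ summand≡hyp p k d+j≢0 e+j≢0 ⟩
    s * hyp (a⁻ q) c d e k    ≡⟨ cong (s *_) (hyp-≡0 (a⁻ q) c d e k (poch-≡0 k a⁻q+m≡0 m<k)) ⟩
    s * 0ℚ                    ≡⟨ ℚ.*-zeroʳ s ⟩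
    0ℚ                        ∎
    where
    open ≡-Reasoning
    s = 6ℚ * ℕ→ℚ k + 1ℚ

  G-start : G 0 ≡ 0ℚ
  G-start = trans (cong (_* B 0) (wzMultiplier-0 q)) (ℚ.*-zeroˡ (B 0))

  G-end : G (3 ℕ.+ m) ≡ 0ℚ
  G-end = trans (cong (R *_) (hyp-≡0 α c d e (3 ℕ.+ m) (poch-≡0 (3 ℕ.+ m) α+[2+m]≡0 (ℕ.n<1+n _))))
                (ℚ.*-zeroʳ R)
    where R = wzMultiplier q (ℕ→ℚ (3 ℕ.+ m))

  sums-relation :
    wzFactor q * q * sumTo (2 ℕ.+ m) (summand p′) + wzFactor q * (q + 4ℚ) * sumTo m (summand p) ≡ 0ℚ
  sums-relation = begin
    u * sumTo (2 ℕ.+ m) (summand p′) + v * sumTo m (summand p)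
      ≡⟨ cong (λ t → u * sumTo (2 ℕ.+ m) (summand p′) + v * t)
              (sumTo-vanishing-tail (summand p) summand-vanishes 2) ⟨
    u * sumTo (2 ℕ.+ m) (summand p′) + v * sumTo (2 ℕ.+ m) (summand p)
      ≡⟨ sumTo-linear u v (summand p′) (summand p) (2 ℕ.+ m) ⟨
    sumTo (2 ℕ.+ m) (λ k → u * summand p′ k + v * summand p k)
      ≡⟨ sumTo-telescope _ G wz-pair (2 ℕ.+ m) ⟩
    G (3 ℕ.+ m) - G 0
      ≡⟨ cong₂ _-_ G-end G-start ⟩
    0ℚ ∎
    where
    open ≡-Reasoning
    u = wzFactor q * q
    v = wzFactor q * (q + 4ℚ)

  sum-step : ∀ ε → sumTo m (summand p) ≡ ε * q → sumTo (2 ℕ.+ m) (summand p′) ≡ - ε * (q + 4ℚ)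
  sum-step ε S≡εq = *-cancelʳ-≢0 (Z * q) (*-≢0 wzFactor≢0 q≢0) (begin
    S′ * (Z * q)
      ≡⟨ solve 4 (λ S′ S Z q → S′ :* (Z :* q)
                   := (Z :* q :* S′ :+ Z :* (q :+ con 4ℚ) :* S) :- Z :* (q :+ con 4ℚ) :* S) refl S′ S Z q ⟩
    (Z * q * S′ + Z * (q + 4ℚ) * S) - Z * (q + 4ℚ) * S
      ≡⟨ cong₂ (λ x y → x - Z * (q + 4ℚ) * y) sums-relation S≡εq ⟩
    0ℚ - Z * (q + 4ℚ) * (ε * q)
      ≡⟨ solve 3 (λ Z q ε → con 0ℚ :- Z :* (q :+ con 4ℚ) :* (ε :* q)
                   := (:- ε) :* (q :+ con 4ℚ) :* (Z :* q)) refl Z q ε ⟩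
    - ε * (q + 4ℚ) * (Z * q) ∎)
    where
    open ≡-Reasoning
    Z = wzFactor q
    S = sumTo m (summand p)
    S′ = sumTo (2 ℕ.+ m) (summand p′)

  sumIdentity-step : SumIdentity p → SumIdentity p′
  sumIdentity-step S≡εq = begin
    sumTo ((p′ ∸ 1) ℕ./ 2) (summand p′)
      ≡⟨ cong (λ n → sumTo n (summand p′)) (half-double (2 ℕ.+ m)) ⟩
    sumTo (2 ℕ.+ m) (summand p′)
      ≡⟨ sum-step ε (subst (λ n → sumTo n (summand p) ≡ ε * q) (half-double m) S≡εq) ⟩
    - ε * (q + 4ℚ)
      ≡⟨ cong₂ _*_ sign-flips (sym q′≡q+4) ⟩
    pow (- 1ℚ) (signExponent p′) * ℕ→ℚ p′ ∎
    where
    open ≡-Reasoning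
    ε = pow (- 1ℚ) (signExponent p)
    sign-flips : - ε ≡ pow (- 1ℚ) (signExponent p′)
    sign-flips = begin
      - ε                                       ≡⟨ solve 1 (λ ε → :- ε := ε :* (:- con 1ℚ)) refl ε ⟩
      ε * - 1ℚ                                  ≡⟨ cong (ε *_) (pow-neg-one-odd (2 ℕ.+ m)) ⟨
      ε * pow (- 1ℚ) p′                         ≡⟨ pow-+ (- 1ℚ) (signExponent p) p′ ⟨
      pow (- 1ℚ) (signExponent p ℕ.+ p′)        ≡⟨ cong (pow (- 1ℚ)) (signExponent-step m) ⟨
      pow (- 1ℚ) (signExponent p′)              ∎

sumIdentity-odd : ∀ m → SumIdentity (suc (2 ℕ.* m))
sumIdentity-odd 0 = refl
sumIdentity-odd 1 = refl
sumIdentity-odd (suc (suc m)) = OddStep.sumIdentity-step m (sumIdentity-odd m)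

even⊎odd : ∀ n → ∃ λ m → n ≡ 2 ℕ.* m ⊎ n ≡ suc (2 ℕ.* m)
even⊎odd zero = 0 , inj₁ refl
even⊎odd (suc n) with even⊎odd n
... | m , inj₁ n≡2m   = m , inj₂ (cong suc n≡2m)
... | m , inj₂ n≡1+2m = suc m , inj₁ (trans (cong suc n≡1+2m) (sym (ℕ.*-suc 2 m)))

mainTheorem12 : (p : ℕ) → Prime p → p ≢ 2 →
    sumTo ((p ∸ 1) ℕ./ 2) (summand p)
      ≡ pow (- 1ℚ) ((p ℕ.* p ∸ 1) ℕ./ 8 ℕ.+ (p ∸ 1) ℕ./ 2) * ℕ→ℚ p
mainTheorem12 p p-prime p≢2 with even⊎odd p
... | m , inj₂ refl = sumIdentity-odd m
... | m , inj₁ refl with prime⇒irreducible p-prime (m∣m*n m)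
...   | inj₁ ()
...   | inj₂ 2≡2m = contradiction (sym 2≡2m) p≢2
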